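{- There is an absolute constant $C$ such that for every $n \ge 4$, the fan graph $F_n$ satisfies $\left|f(F_n) - \frac{n}{4}\right| \le C$.
   Context: The fan graph $F_n$ consists of a path on $n-1$ vertices together with an apex vertex adjacent to all vertices of the path. A path in a graph $G$ is a sequence of distinct vertices $v_0,\dots,v_r$ ($r\ge0$) with consecutive vertices adjacent. A vertex-separating path system of $G$ is a collection of distinct paths in $G$ such that for every pair of distinct vertices $u,v$ some path in the collection contains exactly one of $u$ and $v$. $f(G)$ denotes the minimum size of such a system. -}

module Defs where

open import Data.Nat using (ℕ; zero; suc; _+_; _*_; _≤_)
open import Data.Fin using (Fin; zero; suc; toℕ)
open import Data.List using (List; []; _∷_; length)
open import Data.List.Membership.Propositional using (_∈_)
open import Data.List.Relation.Unary.Unique.Propositional using (Unique)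
open import Data.List.Relation.Unary.Any using (Any)
open import Data.Product using (Σ; _×_; ∃)
open import Data.Sum using (_⊎_)
open import Data.Unit using (⊤)
open import Data.Empty using (⊥)
open import Relation.Nullary using (¬_)
open import Relation.Binary.PropositionalEquality using (_≡_)

-- Fan graph F_n on vertex set Fin n: vertex zero is the apex,
-- vertices suc i (i : Fin (n-1)) form the path 1 - 2 - ... - (n-1) in order.
FanAdj : {n : ℕ} → Fin n → Fin n → Set
FanAdj zero    zero    = ⊥
FanAdj zero    (suc _) = ⊤
FanAdj (suc _) zero    = ⊤
FanAdj (suc i) (suc j) = (suc (toℕ i) ≡ toℕ j) ⊎ (suc (toℕ j) ≡ toℕ i)

Walk : {n : ℕ} → List (Fin n) → Set
Walk []           = ⊤
Walk (x ∷ [])     = ⊤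
Walk (x ∷ y ∷ xs) = FanAdj x y × Walk (y ∷ xs)

IsPath : {n : ℕ} → List (Fin n) → Set
IsPath []         = ⊥
IsPath p@(_ ∷ _)  = Unique p × Walk p

SeparatesBy : {n : ℕ} → List (Fin n) → Fin n → Fin n → Set
SeparatesBy P u v = (u ∈ P × ¬ (v ∈ P)) ⊎ (v ∈ P × ¬ (u ∈ P))

IsSepSystem : (n : ℕ) → List (List (Fin n)) → Set
IsSepSystem n S =
  Unique S ×
  (∀ P → P ∈ S → IsPath P) ×
  (∀ (u v : Fin n) → ¬ (u ≡ v) → Any (λ P → SeparatesBy P u v) S)

IsFanF : (n k : ℕ) → Set
IsFanF n k =
  (Σ (List (List (Fin n))) λ S → IsSepSystem n S × length S ≡ k) ×
  (∀ S → IsSepSystem n S → k ≤ length S)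

-- Call consecutive vertices i, i+1 of the spine (the path F_n minus its apex) a
-- boundary pair of a path P if exactly one of them lies on P. Some path of a separating system
-- separates each of the n - 2 consecutive pairs, so all paths together have at least n - 2
-- boundary pairs. A path passes the apex at most once, so its spine vertices form at most two
-- stretches of consecutive vertices. Adding a spine vertex next to one already present creates
-- no new boundary pair, so each stretch contributes at most two and a path has at most four
-- boundary pairs: 4 f(F_n) ≥ n - 2.
--
-- Write n - 1 = 4m + r and d = 2m. The paths running through the spine intervals
-- [j, j+m), the apex and [d+j, d+j+m), for j < m, separate any two spine positions lying in the
-- same half [0, d) or [d, 2d); the interval [d, 2d) separates the halves, the apex alone
-- separates the apex, and singletons take care of the last r spine vertices: m + r + 2 paths.
--
-- The minimum f(F_n) exists because the separating systems of a given size can be searched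
-- exhaustively.

module Submission where

open import Defs
open import Data.Bool using (Bool; true; false; _∨_)
open import Data.Bool.Properties using (T-≡; ∨-zeroʳ)
open import Data.Fin using (Fin; zero; suc; toℕ; fromℕ; fromℕ<)
open import Data.Fin.Properties
  using (all?; pigeonhole; ¬∀⟶∃¬-smallest; toℕ<n; toℕ-fromℕ; toℕ-fromℕ<; toℕ-inject; toℕ-injective)
  renaming (_≟_ to _≟ᶠ_; suc-injective to fsuc-injective)
open import Data.List using (List; []; _∷_; _++_; length; map; allFin; cartesianProductWith; deduplicate; lookup; [_])
import Data.List.Membership.DecPropositional as DecMembership
open import Data.List.Membership.Propositional using (_∈_; _∉_; lose)
open import Data.List.Membership.Propositional.Properties
  using (∈-allFin; ∈-cartesianProductWith⁺; ∈-deduplicate⁻; ∈-lookup; ∈-map⁻; ∈-map⁺; ∈-++⁻; ∈-++⁺ˡ; ∈-++⁺ʳ)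
open import Data.List.Properties using (≡-dec; length-deduplicate; length-map; length-tabulate; length-++)
open import Data.List.Relation.Binary.Disjoint.Propositional using (Disjoint)
open import Data.List.Relation.Unary.All as All using (All; []; _∷_)
open import Data.List.Relation.Unary.All.Properties using (All¬⇒¬Any; ¬Any⇒All¬)
open import Data.List.Relation.Unary.AllPairs using ([]; _∷_)
open import Data.List.Relation.Unary.Any as Any using (Any; here; there)
import Data.List.Relation.Unary.Any.Properties as AnyProps
open import Data.List.Relation.Unary.Unique.Propositional using (Unique)
open import Data.List.Relation.Unary.Unique.Propositional.Properties using (++⁺)
import Data.List.Relation.Unary.Unique.DecPropositional as UniqueDec
import Data.List.Relation.Unary.Unique.DecPropositional.Properties as UniqueDecProps
open import Data.Nat
  using (ℕ; zero; suc; _+_; _*_; _∸_; pred; _≤_; _<_; z≤n; s≤s; _≤?_; _<?_; _≟_; _≡ᵇ_; _/_; _%_)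
open import Data.Nat.DivMod using (m≡m%n+[m/n]*n; m%n<n)
open import Data.Nat.ListAction using (sum)
open import Data.Nat.Properties
open import Algebra.Properties.CommutativeSemigroup +-commutativeSemigroup using (interchange; x∙yz≈y∙xz)
open import Data.Nat.Tactic.RingSolver using (solve-∀)
open import Data.Product using (Σ; ∃; _×_; _,_; proj₁; proj₂)
import Data.Product as Product
open import Data.Sum using (_⊎_; inj₁; inj₂)
import Data.Sum as Sum
open import Data.Unit using (tt)
open import Function using (_∘_)
open import Function.Bundles using (Equivalence)
open import Relation.Binary.Definitions using (tri<; tri≈; tri>)
open import Relation.Binary.PropositionalEquality
  using (_≡_; _≢_; refl; sym; trans; cong; cong₂; subst; subst₂; module ≡-Reasoning)
open import Relation.Nullary using (¬_; Dec; yes; no; contradiction)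
open import Relation.Nullary.Decidable using (_×-dec_; _⊎-dec_; _→-dec_; ¬?; map′; decidable-stable)
open import Relation.Unary using (Decidable)

-- Existence of f(F_n)

unique⇒length≤ : ∀ {n} {xs : List (Fin n)} → Unique xs → length xs ≤ n
unique⇒length≤ {n} {xs} xs! with length xs ≤? n
... | yes len≤n = len≤n
... | no len≰n with pigeonhole (≰⇒> len≰n) (lookup xs)
...   | i , j , i<j , same = contradiction same (lookup-injective xs! i j i<j)
  where
  lookup-injective : ∀ {A : Set} {xs : List A} → Unique xs →
                     ∀ i j → toℕ i < toℕ j → lookup xs i ≢ lookup xs j
  lookup-injective (x∉ ∷ _)  zero    (suc j) _         = All.lookup x∉ (∈-lookup j)
  lookup-injective (_ ∷ xs!) (suc i) (suc j) (s≤s i<j) = lookup-injective xs! i j i<j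

allLists≤ : ∀ {A : Set} → List A → ℕ → List (List A)
allLists≤ as zero    = [ [] ]
allLists≤ as (suc l) = [] ∷ cartesianProductWith _∷_ as (allLists≤ as l)

∈-allLists≤ : ∀ {A : Set} {as : List A} {l xs} →
              All (_∈ as) xs → length xs ≤ l → xs ∈ allLists≤ as l
∈-allLists≤ {l = zero}  []          _          = here refl
∈-allLists≤ {l = suc l} []          _          = here refl
∈-allLists≤ {l = suc l} (x∈ ∷ xs∈) (s≤s len≤) = there (∈-cartesianProductWith⁺ _∷_ x∈ (∈-allLists≤ xs∈ len≤))

least : ∀ {P : ℕ → Set} → Decidable P → ∀ {u} → P u → ∃ λ k → P k × (∀ {m} → P m → k ≤ m)
least {P} P? {u} Pu
  with ¬∀⟶∃¬-smallest (suc u) (¬_ ∘ P ∘ toℕ) (¬? ∘ P? ∘ toℕ) (λ ¬P → ¬P (fromℕ u) (subst P (sym (toℕ-fromℕ u)) Pu))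
... | k , ¬¬Pk , ¬P-below = toℕ k , decidable-stable (P? (toℕ k)) ¬¬Pk , minimal
  where
  minimal : ∀ {m} → P m → toℕ k ≤ m
  minimal {m} Pm with toℕ k ≤? m
  ... | yes k≤m = k≤m
  ... | no k≰m = contradiction (subst P (sym (trans (toℕ-inject j) (toℕ-fromℕ< (≰⇒> k≰m)))) Pm) (¬P-below j)
    where j = fromℕ< (≰⇒> k≰m)

fanAdj? : ∀ {n} (u v : Fin n) → Dec (FanAdj u v)
fanAdj? zero    zero    = no λ ()
fanAdj? zero    (suc _) = yes tt
fanAdj? (suc _) zero    = yes tt
fanAdj? (suc i) (suc j) = (suc (toℕ i) ≟ toℕ j) ⊎-dec (suc (toℕ j) ≟ toℕ i)

walk? : ∀ {n} (xs : List (Fin n)) → Dec (Walk xs)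
walk? []           = yes tt
walk? (x ∷ [])     = yes tt
walk? (x ∷ y ∷ xs) = fanAdj? x y ×-dec walk? (y ∷ xs)

isPath? : ∀ {n} (xs : List (Fin n)) → Dec (IsPath xs)
isPath? []       = no λ ()
isPath? (x ∷ xs) = UniqueDec.unique? _≟ᶠ_ (x ∷ xs) ×-dec walk? (x ∷ xs)

separatesBy? : ∀ {n} (P : List (Fin n)) u v → Dec (SeparatesBy P u v)
separatesBy? P u v = (u ∈? P ×-dec ¬? (v ∈? P)) ⊎-dec (v ∈? P ×-dec ¬? (u ∈? P))
  where open DecMembership _≟ᶠ_ using (_∈?_)

IsSepFamily : (n : ℕ) → List (List (Fin n)) → Set
IsSepFamily n S = (∀ P → P ∈ S → IsPath P) ×
                  (∀ (u v : Fin n) → u ≢ v → Any (λ P → SeparatesBy P u v) S)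

isSepSystem? : ∀ n (S : List (List (Fin n))) → Dec (IsSepSystem n S)
isSepSystem? n S = UniqueDec.unique? (≡-dec _≟ᶠ_) S ×-dec allPaths? ×-dec
  all? (λ u → all? (λ v → ¬? (u ≟ᶠ v) →-dec Any.any? (λ P → separatesBy? P u v) S))
  where
  allPaths? : Dec (∀ P → P ∈ S → IsPath P)
  allPaths? = map′ (λ all P → All.lookup all) (λ paths → All.tabulate (paths _)) (All.all? isPath? S)

IsSepFamily⇒IsSepSystem : ∀ {n S} → IsSepFamily n S → IsSepSystem n (deduplicate (≡-dec _≟ᶠ_) S)
IsSepFamily⇒IsSepSystem {S = S} (paths , separating) =
  UniqueDecProps.deduplicate-! (≡-dec _≟ᶠ_) S ,
  (λ P P∈ → paths P (∈-deduplicate⁻ (≡-dec _≟ᶠ_) S P∈)) ,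
  λ u v u≢v → AnyProps.deduplicate⁺ (≡-dec _≟ᶠ_) (λ { refl sep → sep }) (separating u v u≢v)

HasSystemOfSize : ℕ → ℕ → Set
HasSystemOfSize n k = Σ (List (List (Fin n))) λ S → IsSepSystem n S × length S ≡ k

hasSystemOfSize? : ∀ n → Decidable (HasSystemOfSize n)
hasSystemOfSize? n k =
  map′ Any.satisfied (λ (S , sys , len) → lose (candidate sys len) (sys , len))
       (Any.any? (λ S → isSepSystem? n S ×-dec (length S ≟ k)) candidates)
  where
  candidates = allLists≤ (allLists≤ (allFin n) n) k
  candidate : ∀ {S} → IsSepSystem n S → length S ≡ k → S ∈ candidates
  candidate (_ , paths , _) refl = ∈-allLists≤ (All.tabulate λ {P} P∈ → listed P (paths P P∈)) ≤-refl
    where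
    listed : ∀ P → IsPath P → P ∈ allLists≤ (allFin n) n
    listed (x ∷ xs) (x∷xs! , _) = ∈-allLists≤ (All.tabulate λ {y} _ → ∈-allFin y) (unique⇒length≤ x∷xs!)

fanF-exists : ∀ {n S} → IsSepFamily n S → ∃ λ k → IsFanF n k × k ≤ length S
fanF-exists {n} {S} family with least (hasSystemOfSize? n) (_ , IsSepFamily⇒IsSepSystem family , refl)
... | k , hasK , minimal =
  k , (hasK , λ S′ sys → minimal (S′ , sys , refl)) ,
  ≤-trans (minimal (_ , IsSepFamily⇒IsSepSystem family , refl)) (length-deduplicate (≡-dec _≟ᶠ_) S)

-- Counting changes in Boolean sequences

differs : Bool → Bool → ℕ
differs false true  = 1
differs true  false = 1
differs _     _     = 0

differs≤1 : ∀ x y → differs x y ≤ 1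
differs≤1 false false = z≤n
differs≤1 false true  = ≤-refl
differs≤1 true  false = ≤-refl
differs≤1 true  true  = z≤n

differs-triangle : ∀ x y z → differs x z ≤ differs x y + differs y z
differs-triangle false false z     = ≤-refl
differs-triangle true  true  z     = ≤-refl
differs-triangle false true  false = z≤n
differs-triangle false true  true  = ≤-refl
differs-triangle true  false false = ≤-refl
differs-triangle true  false true  = z≤n

differs-≢ : ∀ {x y} → x ≢ y → 1 ≤ differs x y
differs-≢ {false} {false} x≢y = contradiction refl x≢y
differs-≢ {false} {true}  _   = ≤-refl
differs-≢ {true}  {false} _   = ≤-refl
differs-≢ {true}  {true}  x≢y = contradiction refl x≢y

changes : ℕ → (ℕ → Bool) → ℕ
changes zero    s = 0
changes (suc k) s = differs (s 0) (s 1) + changes k (λ i → s (suc i))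

changes-false : ∀ k → changes k (λ _ → false) ≡ 0
changes-false zero    = refl
changes-false (suc k) = changes-false k

insert : ℕ → (ℕ → Bool) → ℕ → Bool
insert a s i = (a ≡ᵇ i) ∨ s i

insert-self : ∀ a s → insert a s a ≡ true
insert-self a s = cong (_∨ s a) (Equivalence.to T-≡ (≡⇒≡ᵇ a a refl))

changes-insert-0 : ∀ k s → changes k (insert 0 s) ≤ differs true (s 0) + changes k s
changes-insert-0 zero    s = z≤n
changes-insert-0 (suc k) s =
  ≤-trans (+-monoˡ-≤ rest (differs-triangle true (s 0) (s 1)))
          (≤-reflexive (+-assoc (differs true (s 0)) (differs (s 0) (s 1)) rest))
  where rest = changes k (λ i → s (suc i))

changes-insert : ∀ k a s → changes k (insert a s) ≤ 2 + changes k s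
changes-insert zero    a s = z≤n
changes-insert (suc k) zero s =
  ≤-trans (changes-insert-0 (suc k) s)
          (+-monoˡ-≤ (changes (suc k) s) (≤-trans (differs≤1 true (s 0)) (n≤1+n 1)))
changes-insert (suc k) (suc zero) s = begin
  differs (s 0) true + changes k (insert 0 t) ≤⟨ +-mono-≤ (differs≤1 (s 0) true) (changes-insert-0 k t) ⟩
  1 + (differs true (s 1) + changes k t)      ≤⟨ +-monoʳ-≤ 1 (+-monoˡ-≤ (changes k t) (differs≤1 true (s 1))) ⟩
  2 + changes k t                             ≤⟨ +-monoʳ-≤ 2 (m≤n+m (changes k t) (differs (s 0) (s 1))) ⟩
  2 + changes (suc k) s                       ∎
  where
  open ≤-Reasoning
  t = λ i → s (suc i)
changes-insert (suc k) (suc (suc a)) s =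
  ≤-trans (+-monoʳ-≤ d (changes-insert k (suc a) t)) (≤-reflexive (x∙yz≈y∙xz d 2 (changes k t)))
  where
  t = λ i → s (suc i)
  d = differs (s 0) (s 1)

changes-insert-before-member : ∀ k a s → suc a ≤ k → s (suc a) ≡ true → changes k (insert a s) ≤ changes k s
changes-insert-before-member (suc k) zero s _ s₁ rewrite s₁ = m≤n+m _ (differs (s 0) true)
changes-insert-before-member (suc (suc k)) (suc zero) s _ s₂ rewrite s₂ =
  ≤-trans (+-monoˡ-≤ rest (differs-triangle (s 0) (s 1) true))
          (≤-reflexive (+-assoc (differs (s 0) (s 1)) (differs (s 1) true) rest))
  where rest = changes k (λ i → s (suc (suc i)))
changes-insert-before-member (suc k) (suc (suc a)) s (s≤s a<k) sa =
  +-monoʳ-≤ (differs (s 0) (s 1)) (changes-insert-before-member k (suc a) (λ i → s (suc i)) a<k sa)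

changes-insert-after-member : ∀ k a s → suc a ≤ k → s a ≡ true → changes k (insert (suc a) s) ≤ changes k s
changes-insert-after-member (suc k) zero s _ s₀ rewrite s₀ = changes-insert-0 k (λ i → s (suc i))
changes-insert-after-member (suc k) (suc a) s (s≤s a<k) sa =
  +-monoʳ-≤ (differs (s 0) (s 1)) (changes-insert-after-member k a (λ i → s (suc i)) a<k sa)

module _ {A : Set} where

  sum-map-+ : ∀ (f g : A → ℕ) xs → sum (map (λ x → f x + g x) xs) ≡ sum (map f xs) + sum (map g xs)
  sum-map-+ f g []       = refl
  sum-map-+ f g (x ∷ xs) = trans (cong (f x + g x +_) (sum-map-+ f g xs)) (interchange (f x) (g x) _ _)

  sum-map-≤ : ∀ (f : A → ℕ) c xs → (∀ x → x ∈ xs → f x ≤ c) → sum (map f xs) ≤ length xs * c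
  sum-map-≤ f c []       _     = z≤n
  sum-map-≤ f c (x ∷ xs) bound =
    +-mono-≤ (bound x (here refl)) (sum-map-≤ f c xs (λ y y∈ → bound y (there y∈)))

  sum-map-Any : ∀ (f : A → ℕ) {xs} → Any (λ x → 1 ≤ f x) xs → 1 ≤ sum (map f xs)
  sum-map-Any f (here  pos) = ≤-trans pos (m≤m+n _ _)
  sum-map-Any f (there pos) = ≤-trans (sum-map-Any f pos) (m≤n+m _ _)

  changes-sum : ∀ k (seq : A → ℕ → Bool) xs → (∀ i → i < k → Any (λ x → seq x i ≢ seq x (suc i)) xs) →
                k ≤ sum (map (λ x → changes k (seq x)) xs)
  changes-sum zero    seq xs _        = z≤n
  changes-sum (suc k) seq xs changing = begin
    1 + k                                         ≤⟨ +-mono-≤ initial-changes later-changes ⟩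
    sum (map initial xs) + sum (map later xs)     ≡⟨ sum-map-+ initial later xs ⟨
    sum (map (λ x → changes (suc k) (seq x)) xs)  ∎
    where
    open ≤-Reasoning
    initial = λ x → differs (seq x 0) (seq x 1)
    later = λ x → changes k (λ i → seq x (suc i))
    initial-changes : 1 ≤ sum (map initial xs)
    initial-changes = sum-map-Any initial (Any.map differs-≢ (changing 0 (s≤s z≤n)))
    later-changes : k ≤ sum (map later xs)
    later-changes = changes-sum k (λ x i → seq x (suc i)) xs (λ i i<k → changing (suc i) (s≤s i<k))

-- Lower bound

Walk-tail : ∀ {n} {x : Fin n} W → Walk (x ∷ W) → Walk W
Walk-tail []      _          = tt
Walk-tail (_ ∷ _) (_ , walk) = walk

<pred⇒suc< : ∀ {i n} → i < pred n → suc i < n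
<pred⇒suc< {n = suc n} i<n = s≤s i<n

module _ {N : ℕ} where

  spinePositions : List (Fin (suc N)) → ℕ → Bool
  spinePositions []          = λ _ → false
  spinePositions (zero ∷ W)  = spinePositions W
  spinePositions (suc j ∷ W) = insert (toℕ j) (spinePositions W)

  boundary : List (Fin (suc N)) → ℕ
  boundary W = changes (pred N) (spinePositions W)

  spinePositions-∈⁺ : ∀ {j W} → suc j ∈ W → spinePositions W (toℕ j) ≡ true
  spinePositions-∈⁺ {j} {suc _ ∷ W} (here refl) = insert-self (toℕ j) (spinePositions W)
  spinePositions-∈⁺ {j} {zero ∷ W}  (there j∈) = spinePositions-∈⁺ j∈
  spinePositions-∈⁺ {j} {suc k ∷ W} (there j∈) rewrite spinePositions-∈⁺ j∈ = ∨-zeroʳ _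

  spinePositions-∈⁻ : ∀ {j} W → spinePositions W (toℕ j) ≡ true → suc j ∈ W
  spinePositions-∈⁻ (zero ∷ W) j∈ = there (spinePositions-∈⁻ W j∈)
  spinePositions-∈⁻ {j} (suc k ∷ W) j∈ with toℕ k ≡ᵇ toℕ j in k≡j
  ... | true  = here (cong suc (toℕ-injective (sym (≡ᵇ⇒≡ (toℕ k) (toℕ j) (Equivalence.from T-≡ k≡j)))))
  ... | false = there (spinePositions-∈⁻ W j∈)

  separates⇒spinePositions-≢ : ∀ {P j k} → SeparatesBy P (suc j) (suc k) →
                              spinePositions P (toℕ j) ≢ spinePositions P (toℕ k)
  separates⇒spinePositions-≢ {P} (inj₁ (j∈ , k∉)) same =
    k∉ (spinePositions-∈⁻ P (trans (sym same) (spinePositions-∈⁺ j∈)))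
  separates⇒spinePositions-≢ {P} (inj₂ (k∈ , j∉)) same =
    j∉ (spinePositions-∈⁻ P (trans same (spinePositions-∈⁺ k∈)))

  boundary-adjacent : ∀ {j k} W → FanAdj (suc j) (suc k) → boundary (suc j ∷ suc k ∷ W) ≤ boundary (suc k ∷ W)
  boundary-adjacent {j} {k} W (inj₁ j+1≡k) =
    changes-insert-before-member (pred N) (toℕ j) s
      (suc[m]≤n⇒m≤pred[n] (subst (_< N) (sym j+1≡k) (toℕ<n k)))
      (subst (λ i → s i ≡ true) (sym j+1≡k) (insert-self (toℕ k) (spinePositions W)))
    where s = spinePositions (suc k ∷ W)
  boundary-adjacent {j} {k} W (inj₂ k+1≡j) =
    subst (λ i → changes (pred N) (insert i s) ≤ changes (pred N) s) k+1≡j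
      (changes-insert-after-member (pred N) (toℕ k) s
        (suc[m]≤n⇒m≤pred[n] (subst (_< N) (sym k+1≡j) (toℕ<n j)))
        (insert-self (toℕ k) (spinePositions W)))
    where s = spinePositions (suc k ∷ W)

  boundary-[] : boundary [] ≡ 0
  boundary-[] = changes-false (pred N)

  boundary-∷ : ∀ j W → boundary (suc j ∷ W) ≤ 2 + boundary W
  boundary-∷ j W = changes-insert (pred N) (toℕ j) (spinePositions W)

  boundary-apexFree : ∀ W → Walk W → zero ∉ W → boundary W ≤ 2
  boundary-apexFree []                  _            _     = ≤-trans (≤-reflexive boundary-[]) z≤n
  boundary-apexFree (zero ∷ W)          _            apex∉ = contradiction (here refl) apex∉
  boundary-apexFree (suc j ∷ [])        _            _     = ≤-trans (boundary-∷ j []) (≤-reflexive (cong (2 +_) boundary-[]))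
  boundary-apexFree (suc j ∷ zero ∷ W)  _            apex∉ = contradiction (there (here refl)) apex∉
  boundary-apexFree (suc j ∷ suc k ∷ W) (adj , walk) apex∉ =
    ≤-trans (boundary-adjacent W adj) (boundary-apexFree (suc k ∷ W) walk (apex∉ ∘ there))

  boundary-path : ∀ P → IsPath P → boundary P ≤ 4
  boundary-path (x ∷ W) (P! , walk) = bound (x ∷ W) P! walk
    where
    bound : ∀ W → Unique W → Walk W → boundary W ≤ 4
    bound []                  _               _            = ≤-trans (≤-reflexive boundary-[]) z≤n
    bound (zero ∷ W)          (apex∉ ∷ _)     walk         =
      ≤-trans (boundary-apexFree W (Walk-tail W walk) (All¬⇒¬Any apex∉)) (m≤m+n 2 2)
    bound (suc j ∷ [])        _               _            =
      ≤-trans (boundary-apexFree (suc j ∷ []) tt λ { (here ()) ; (there ()) }) (m≤m+n 2 2)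
    bound (suc j ∷ zero ∷ W)  (_ ∷ apex∉ ∷ _) (_ , walk)   =
      ≤-trans (boundary-∷ j (zero ∷ W)) (+-monoʳ-≤ 2 (boundary-apexFree W (Walk-tail W walk) (All¬⇒¬Any apex∉)))
    bound (suc j ∷ suc k ∷ W) (_ ∷ W!)        (adj , walk) =
      ≤-trans (boundary-adjacent W adj) (bound (suc k ∷ W) W! walk)

  spine-lowerBound : ∀ {S} → IsSepFamily (suc N) S → pred N ≤ 4 * length S
  spine-lowerBound {S} (paths , separating) = begin
    pred N                    ≤⟨ changes-sum (pred N) spinePositions S neighbours-separated ⟩
    sum (map boundary S)      ≤⟨ sum-map-≤ boundary 4 S (λ P P∈ → boundary-path P (paths P P∈)) ⟩
    length S * 4              ≡⟨ *-comm (length S) 4 ⟩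
    4 * length S              ∎
    where
    open ≤-Reasoning
    neighbours-separated : ∀ i → i < pred N → Any (λ P → spinePositions P i ≢ spinePositions P (suc i)) S
    neighbours-separated i i<N-1 =
      Any.map (λ {P} → subst₂ (λ a b → spinePositions P a ≢ spinePositions P b) (toℕ-fromℕ< i<N) (toℕ-fromℕ< i+1<N)
                       ∘ separates⇒spinePositions-≢)
              (separating (suc (fromℕ< i<N)) (suc (fromℕ< i+1<N)) distinct)
      where
      i+1<N : suc i < N
      i+1<N = <pred⇒suc< i<N-1
      i<N : i < N
      i<N = ≤-trans (n≤1+n (suc i)) i+1<N
      distinct : suc (fromℕ< i<N) ≢ suc (fromℕ< i+1<N)
      distinct eq = 1+n≢n (sym (subst₂ _≡_ (toℕ-fromℕ< i<N) (toℕ-fromℕ< i+1<N) (cong toℕ (fsuc-injective eq))))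

lowerBound : ∀ {n S} → IsSepFamily n S → n ≤ 2 + 4 * length S
lowerBound {zero}  _      = z≤n
lowerBound {suc N} family = ≤-trans (suc≤2+pred N) (+-monoʳ-≤ 2 (spine-lowerBound family))
  where
  suc≤2+pred : ∀ N → suc N ≤ 2 + pred N
  suc≤2+pred zero    = s≤s z≤n
  suc≤2+pred (suc N) = ≤-refl

fanF-lowerBound : ∀ {n k} → IsFanF n k → n ≤ 2 + 4 * k
fanF-lowerBound ((_ , (_ , family) , refl) , _) = lowerBound family

-- Upper bound

IsApexFreePath : ∀ {n} → List (Fin (suc n)) → Set
IsApexFreePath W = Unique W × Walk W × zero ∉ W

walk-through-apex : ∀ {n} (xs : List (Fin (suc n))) {ys} →
                    Walk xs → zero ∉ xs → Walk (zero ∷ ys) → Walk (xs ++ zero ∷ ys)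
walk-through-apex []           _            _     walk′ = walk′
walk-through-apex (zero ∷ _)   _            apex∉ _     = contradiction (here refl) apex∉
walk-through-apex (suc _ ∷ []) _            _     walk′ = tt , walk′
walk-through-apex (x ∷ y ∷ xs) (adj , walk) apex∉ walk′ = adj , walk-through-apex (y ∷ xs) walk (apex∉ ∘ there) walk′

walk-from-apex : ∀ {n} (ys : List (Fin (suc n))) → Walk ys → zero ∉ ys → Walk (zero ∷ ys)
walk-from-apex []          _    _     = tt
walk-from-apex (zero ∷ _)  _    apex∉ = contradiction (here refl) apex∉
walk-from-apex (suc _ ∷ _) walk _     = tt , walk

join-at-apex : ∀ {n} {xs ys : List (Fin (suc n))} →
               IsApexFreePath xs → IsApexFreePath ys → Disjoint xs ys → IsPath (xs ++ zero ∷ ys)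
join-at-apex {xs = xs} {ys} (xs! , xs-walk , apex∉xs) (ys! , ys-walk , apex∉ys) disjoint =
  nonempty xs unique walk
  where
  unique : Unique (xs ++ zero ∷ ys)
  unique = ++⁺ xs! (¬Any⇒All¬ ys apex∉ys ∷ ys!)
    λ { (v∈xs , here refl) → apex∉xs v∈xs ; (v∈xs , there v∈ys) → disjoint (v∈xs , v∈ys) }
  walk : Walk (xs ++ zero ∷ ys)
  walk = walk-through-apex xs xs-walk apex∉xs (walk-from-apex ys ys-walk apex∉ys)
  nonempty : ∀ ws → Unique (ws ++ zero ∷ ys) → Walk (ws ++ zero ∷ ys) → IsPath (ws ++ zero ∷ ys)
  nonempty []      ws! ws-walk = ws! , ws-walk
  nonempty (_ ∷ _) ws! ws-walk = ws! , ws-walk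

head-bound : ∀ {a l N} → a + suc l ≤ N → a < N
head-bound {a} a+l≤N = ≤-trans (m<m+n a (s≤s z≤n)) a+l≤N

tail-bound : ∀ {a l N} → a + suc l ≤ N → suc a + l ≤ N
tail-bound {a} {l} {N} = subst (_≤ N) (+-suc a l)

module _ {N : ℕ} where

  segment : (a l : ℕ) → .(a + l ≤ N) → List (Fin (suc N))
  segment a zero    _      = []
  segment a (suc l) a+l≤N = suc (fromℕ< (head-bound a+l≤N)) ∷ segment (suc a) l (tail-bound a+l≤N)

  length-segment : ∀ a l .(a+l≤N : a + l ≤ N) → length (segment a l a+l≤N) ≡ l
  length-segment a zero    _      = refl
  length-segment a (suc l) a+l≤N = cong suc (length-segment (suc a) l (tail-bound a+l≤N))

  apex∉segment : ∀ a l .(a+l≤N : a + l ≤ N) → zero ∉ segment a l a+l≤N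
  apex∉segment a (suc l) a+l≤N (there apex∈) = apex∉segment (suc a) l (tail-bound a+l≤N) apex∈

  ∈-segment⁻ : ∀ {i} a l .(a+l≤N : a + l ≤ N) → suc i ∈ segment a l a+l≤N → a ≤ toℕ i × toℕ i < a + l
  ∈-segment⁻ {i} a (suc l) a+l≤N (here eq) =
    ≤-reflexive (sym i≡a) , subst (_< a + suc l) (sym i≡a) (m<m+n a (s≤s z≤n))
    where i≡a = trans (cong toℕ (fsuc-injective eq)) (toℕ-fromℕ< (head-bound a+l≤N))
  ∈-segment⁻ {i} a (suc l) a+l≤N (there i∈) with ∈-segment⁻ (suc a) l (tail-bound a+l≤N) i∈
  ... | a<i , i<a+l = <⇒≤ a<i , subst (toℕ i <_) (sym (+-suc a l)) i<a+l

  ∈-segment⁺ : ∀ {i} a l .(a+l≤N : a + l ≤ N) → a ≤ toℕ i → toℕ i < a + l → suc i ∈ segment a l a+l≤N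
  ∈-segment⁺ {i} a zero    _      a≤i i<a = contradiction (subst (toℕ i <_) (+-identityʳ a) i<a) (≤⇒≯ a≤i)
  ∈-segment⁺ {i} a (suc l) a+l≤N a≤i i<a+l with m≤n⇒m<n∨m≡n a≤i
  ... | inj₂ a≡i = here (cong suc (toℕ-injective (trans (sym a≡i) (sym (toℕ-fromℕ< (head-bound a+l≤N))))))
  ... | inj₁ a<i = there (∈-segment⁺ (suc a) l (tail-bound a+l≤N) a<i (subst (toℕ i <_) (+-suc a l) i<a+l))

  segment-unique : ∀ a l .(a+l≤N : a + l ≤ N) → Unique (segment a l a+l≤N)
  segment-unique a zero    _      = []
  segment-unique a (suc l) a+l≤N = ¬Any⇒All¬ _ first∉rest ∷ segment-unique (suc a) l (tail-bound a+l≤N)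
    where
    first∉rest : suc (fromℕ< (head-bound a+l≤N)) ∉ segment (suc a) l (tail-bound a+l≤N)
    first∉rest first∈ =
      <-irrefl (sym (toℕ-fromℕ< (head-bound a+l≤N))) (proj₁ (∈-segment⁻ (suc a) l (tail-bound a+l≤N) first∈))

  segment-walk : ∀ a l .(a+l≤N : a + l ≤ N) → Walk (segment a l a+l≤N)
  segment-walk a zero          _      = tt
  segment-walk a (suc zero)    _      = tt
  segment-walk a (suc (suc l)) a+l≤N =
    inj₁ (trans (cong suc (toℕ-fromℕ< (head-bound a+l≤N))) (sym (toℕ-fromℕ< (head-bound (tail-bound a+l≤N))))) ,
    segment-walk (suc a) (suc l) (tail-bound a+l≤N)

  segment-isApexFreePath : ∀ a l .(a+l≤N : a + l ≤ N) → IsApexFreePath (segment a l a+l≤N)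
  segment-isApexFreePath a l a+l≤N = segment-unique a l a+l≤N , segment-walk a l a+l≤N , apex∉segment a l a+l≤N

  segment-isPath : ∀ a l .(a+l≤N : a + l ≤ N) → 1 ≤ l → IsPath (segment a l a+l≤N)
  segment-isPath a (suc l) a+l≤N _ = segment-unique a (suc l) a+l≤N , segment-walk a (suc l) a+l≤N

Exactly-one : Set → Set → Set
Exactly-one A B = (A × ¬ B) ⊎ (B × ¬ A)

module Construction (N m r : ℕ) (1≤m : 1 ≤ m) (N≡ : (m + m) + (m + m) + r ≡ N) where

  d : ℕ
  d = m + m

  InWindow : ℕ → ℕ → Set
  InWindow j a = j ≤ a × a < j + m

  in-window : ∀ {j a b} → j < m → Exactly-one (InWindow j a) (InWindow j b) →
              ∃ λ (j : Fin m) → Exactly-one (InWindow (toℕ j) a) (InWindow (toℕ j) b)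
  in-window {j} {a} {b} j<m sep =
    fromℕ< j<m , subst (λ k → Exactly-one (InWindow k a) (InWindow k b)) (sym (toℕ-fromℕ< j<m)) sep

  -- The window ending at a starts at a + 1 - m; if that is negative, the window starting at a or a + 1 works.
  windows-separate : ∀ {a b} → a < b → b < d → ∃ λ (j : Fin m) → Exactly-one (InWindow (toℕ j) a) (InWindow (toℕ j) b)
  windows-separate {a} {b} a<b b<d with m ≤? suc a
  ... | yes m≤a+1 = in-window j<m (inj₁ ((j≤a , a<j+m) , λ (_ , b<j+m) → <⇒≱ b<j+m (subst (_≤ b) (sym j+m≡a+1) a<b)))
    where
    j = suc a ∸ m
    j+m≡a+1 : j + m ≡ suc a
    j+m≡a+1 = m∸n+n≡m m≤a+1
    j<m : j < m
    j<m = +-cancelʳ-< m j m (subst (_< d) (sym j+m≡a+1) (≤-<-trans a<b b<d))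
    j≤a : j ≤ a
    j≤a = ≤-pred (subst (suc j ≤_) j+m≡a+1 (subst (_≤ j + m) (+-comm j 1) (+-monoʳ-≤ j 1≤m)))
    a<j+m : a < j + m
    a<j+m = ≤-reflexive (sym j+m≡a+1)
  ... | no m≰a+1 with a + m ≤? b
  ...   | yes a+m≤b = in-window a<m (inj₁ ((≤-refl , m<m+n a 1≤m) , λ (_ , b<a+m) → <⇒≱ b<a+m a+m≤b))
    where a<m = ≤-trans (n≤1+n (suc a)) (≰⇒> m≰a+1)
  ...   | no a+m≰b =
    in-window (≰⇒> m≰a+1) (inj₂ ((a<b , ≤-trans (≰⇒> a+m≰b) (n≤1+n _)) , λ (a+1≤a , _) → <-irrefl refl a+1≤a))

  dd+r≤N : d + d + r ≤ N
  dd+r≤N = ≤-reflexive N≡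

  dd≤N : d + d ≤ N
  dd≤N = ≤-trans (m≤m+n (d + d) r) dd+r≤N

  window-end≤d : (j : Fin m) → toℕ j + m ≤ d
  window-end≤d j = +-monoˡ-≤ m (<⇒≤ (toℕ<n j))

  low-fits : (j : Fin m) → toℕ j + m ≤ N
  low-fits j = ≤-trans (window-end≤d j) (≤-trans (m≤m+n d d) dd≤N)

  high-fits : (j : Fin m) → d + toℕ j + m ≤ N
  high-fits j = ≤-trans (≤-reflexive (+-assoc d (toℕ j) m)) (≤-trans (+-monoʳ-≤ d (window-end≤d j)) dd≤N)

  lowerPart upperPart : Fin m → List (Fin (suc N))
  lowerPart j = segment (toℕ j) m (low-fits j)
  upperPart j = segment (d + toℕ j) m (high-fits j)

  window : Fin m → List (Fin (suc N))
  window j = lowerPart j ++ zero ∷ upperPart j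

  LiesOver : ℕ → ℕ → Set
  LiesOver x a = x ≡ a ⊎ x ≡ d + a

  ∈-window⁺ : ∀ {j i a} → LiesOver (toℕ i) a → InWindow (toℕ j) a → suc i ∈ window j
  ∈-window⁺ {j} (inj₁ refl) (j≤a , a<j+m) = ∈-++⁺ˡ (∈-segment⁺ (toℕ j) m (low-fits j) j≤a a<j+m)
  ∈-window⁺ {j} {a = a} (inj₂ i≡d+a) (j≤a , a<j+m) =
    ∈-++⁺ʳ (lowerPart j) (there (∈-segment⁺ (d + toℕ j) m (high-fits j)
      (subst (d + toℕ j ≤_) (sym i≡d+a) (+-monoʳ-≤ d j≤a))
      (subst₂ _<_ (sym i≡d+a) (sym (+-assoc d (toℕ j) m)) (+-monoʳ-< d a<j+m))))

  ∈-window⁻ : ∀ {j i a} → a < d → LiesOver (toℕ i) a → suc i ∈ window j → InWindow (toℕ j) a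
  ∈-window⁻ {j} {i} {a} a<d over i∈ with ∈-++⁻ (lowerPart j) i∈ | over
  ... | inj₁ i∈low | inj₁ refl = ∈-segment⁻ (toℕ j) m (low-fits j) i∈low
  ... | inj₁ i∈low | inj₂ i≡d+a =
    contradiction (≤-trans (m≤m+n d a) (≤-reflexive (sym i≡d+a)))
                  (<⇒≱ (<-≤-trans (proj₂ (∈-segment⁻ (toℕ j) m (low-fits j) i∈low)) (window-end≤d j)))
  ... | inj₂ (there i∈high) | inj₁ refl =
    contradiction (≤-trans (m≤m+n d (toℕ j)) (proj₁ (∈-segment⁻ (d + toℕ j) m (high-fits j) i∈high))) (<⇒≱ a<d)
  ... | inj₂ (there i∈high) | inj₂ i≡d+a with ∈-segment⁻ (d + toℕ j) m (high-fits j) i∈high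
  ...   | d+j≤i , i<d+j+m = +-cancelˡ-≤ d (toℕ j) a (subst (d + toℕ j ≤_) i≡d+a d+j≤i) ,
                            +-cancelˡ-< d a (toℕ j + m) (subst₂ _<_ i≡d+a (+-assoc d (toℕ j) m) i<d+j+m)

  window-path : ∀ j → IsPath (window j)
  window-path j =
    join-at-apex (segment-isApexFreePath (toℕ j) m (low-fits j)) (segment-isApexFreePath (d + toℕ j) m (high-fits j)) disjoint
    where
    disjoint : Disjoint (lowerPart j) (upperPart j)
    disjoint {zero}  (apex∈ , _)      = apex∉segment (toℕ j) m (low-fits j) apex∈
    disjoint {suc i} (i∈low , i∈high) =
      <⇒≱ (proj₂ (∈-segment⁻ (toℕ j) m (low-fits j) i∈low))
          (≤-trans (≤-trans (window-end≤d j) (m≤m+n d (toℕ j))) (proj₁ (∈-segment⁻ (d + toℕ j) m (high-fits j) i∈high)))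

  upperHalf : List (Fin (suc N))
  upperHalf = segment d d dd≤N

  singletons : List (List (Fin (suc N)))
  singletons = map [_] (segment (d + d) r dd+r≤N)

  windows : List (List (Fin (suc N)))
  windows = map window (allFin m)

  family : List (List (Fin (suc N)))
  family = [ zero ] ∷ windows ++ upperHalf ∷ singletons

  family-length : length family ≡ 2 + m + r
  family-length = cong suc (begin
    length (windows ++ upperHalf ∷ singletons)      ≡⟨ length-++ windows ⟩
    length windows + suc (length singletons)    ≡⟨ cong₂ (λ w s → w + suc s) windows-length singletons-length ⟩
    m + suc r                                   ≡⟨ +-suc m r ⟩
    suc m + r                                   ∎)
    where
    open ≡-Reasoning
    windows-length : length windows ≡ m
    windows-length = trans (length-map window (allFin m)) (length-tabulate _)
    singletons-length : length singletons ≡ r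
    singletons-length = trans (length-map [_] (segment (d + d) r dd+r≤N)) (length-segment (d + d) r dd+r≤N)

  family-paths : ∀ P → P ∈ family → IsPath P
  family-paths _ (here refl) = [] ∷ [] , tt
  family-paths P (there P∈) with ∈-++⁻ windows P∈
  ... | inj₁ P∈windows with ∈-map⁻ window P∈windows
  ...   | j , _ , refl = window-path j
  family-paths P (there P∈) | inj₂ (here refl) = segment-isPath d d dd≤N (≤-trans 1≤m (m≤m+n m m))
  family-paths P (there P∈) | inj₂ (there P∈singletons) with ∈-map⁻ [_] P∈singletons
  ... | _ , _ , refl = [] ∷ [] , tt

  Separated : Fin (suc N) → Fin (suc N) → Set
  Separated u v = Any (λ P → SeparatesBy P u v) family

  separated-by-window : ∀ {i i' a b} → LiesOver (toℕ i) a → LiesOver (toℕ i') b → a < b → b < d →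
                        Separated (suc i) (suc i')
  separated-by-window i-over i'-over a<b b<d with windows-separate a<b b<d
  ... | j , sep = lose (there (∈-++⁺ˡ (∈-map⁺ window (∈-allFin j))))
    (Sum.map (Product.map (∈-window⁺ i-over)  (λ ¬b i'∈ → ¬b (∈-window⁻ b<d i'-over i'∈)))
             (Product.map (∈-window⁺ i'-over) (λ ¬a i∈ → ¬a (∈-window⁻ (<-trans a<b b<d) i-over i∈))) sep)

  separated-< : ∀ {i i'} → toℕ i < toℕ i' → Separated (suc i) (suc i')
  separated-< {i} {i'} i<i' with d + d ≤? toℕ i'
  ... | yes far = lose (there (∈-++⁺ʳ windows (there (∈-map⁺ [_] i'∈tail))))
                       (inj₂ (here refl , λ { (here eq) → <-irrefl (cong toℕ (fsuc-injective eq)) i<i' ; (there ()) }))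
    where
    i'∈tail : suc i' ∈ segment (d + d) r dd+r≤N
    i'∈tail = ∈-segment⁺ (d + d) r dd+r≤N far (subst (toℕ i' <_) (sym N≡) (toℕ<n i'))
  ... | no near with toℕ i' <? d
  ...   | yes i'<d = separated-by-window (inj₁ refl) (inj₁ refl) i<i' i'<d
  ...   | no i'≮d with toℕ i <? d
  ...     | yes i<d = lose (there (∈-++⁺ʳ windows (here refl)))
                           (inj₂ (∈-segment⁺ d d dd≤N (≮⇒≥ i'≮d) (≰⇒> near) ,
                                  λ i∈ → <⇒≱ i<d (proj₁ (∈-segment⁻ d d dd≤N i∈))))
  ...     | no i≮d = separated-by-window (inj₂ (sym (m+[n∸m]≡n (≮⇒≥ i≮d)))) (inj₂ i'≡d+[i'∸d])
                       (∸-monoˡ-< i<i' (≮⇒≥ i≮d))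
                       (+-cancelˡ-< d _ d (subst (_< d + d) i'≡d+[i'∸d] (≰⇒> near)))
    where
    i'≡d+[i'∸d] : toℕ i' ≡ d + (toℕ i' ∸ d)
    i'≡d+[i'∸d] = sym (m+[n∸m]≡n (≮⇒≥ i'≮d))

  family-separates : ∀ u v → u ≢ v → Separated u v
  family-separates zero    zero     u≢v = contradiction refl u≢v
  family-separates zero    (suc _)  _   = here (inj₁ (here refl , λ { (here ()) ; (there ()) }))
  family-separates (suc _) zero     _   = here (inj₂ (here refl , λ { (here ()) ; (there ()) }))
  family-separates (suc i) (suc i') u≢v with <-cmp (toℕ i) (toℕ i')
  ... | tri< i<i' _ _ = separated-< i<i'
  ... | tri≈ _ i≡i' _ = contradiction (cong suc (toℕ-injective i≡i')) u≢v
  ... | tri> _ _ i'<i = Any.map Sum.swap (separated-< i'<i)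

  isSepFamily : IsSepFamily (suc N) family
  isSepFamily = family-paths , family-separates

singletons-family : ∀ n → IsSepFamily n (map [_] (allFin n))
singletons-family n = paths , λ u v u≢v →
  lose (∈-map⁺ [_] (∈-allFin u)) (inj₁ (here refl , λ { (here v≡u) → u≢v (sym v≡u) ; (there ()) }))
  where
  paths : ∀ P → P ∈ map [_] (allFin n) → IsPath P
  paths P P∈ with ∈-map⁻ [_] P∈
  ... | _ , _ , refl = [] ∷ [] , tt

size-bound : ∀ m r → r < 4 → 4 * (2 + m + r) ≤ suc ((m + m) + (m + m) + r) + 16
size-bound m r r<4 = begin
  4 * (2 + m + r)                      ≡⟨ expand m r ⟩
  (m + m) + (m + m) + r + 8 + 3 * r    ≤⟨ +-monoʳ-≤ ((m + m) + (m + m) + r + 8) (*-monoʳ-≤ 3 (≤-pred r<4)) ⟩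
  (m + m) + (m + m) + r + 8 + 3 * 3    ≡⟨ collect m r ⟩
  suc ((m + m) + (m + m) + r) + 16     ∎
  where
  open ≤-Reasoning
  expand : ∀ m r → 4 * (2 + m + r) ≡ (m + m) + (m + m) + r + 8 + 3 * r
  expand = solve-∀
  collect : ∀ m r → (m + m) + (m + m) + r + 8 + 3 * 3 ≡ suc ((m + m) + (m + m) + r) + 16
  collect = solve-∀

upperBound : ∀ n → ∃ λ S → IsSepFamily n S × 4 * length S ≤ n + 16
upperBound zero    = [] , singletons-family 0 , z≤n
upperBound (suc N) =
  by-quarters N (N / 4) (N % 4) (m%n<n N 4) (sym (trans (m≡m%n+[m/n]*n N 4) (shape (N / 4) (N % 4))))
  where
  shape : ∀ q r → r + q * 4 ≡ (q + q) + (q + q) + r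
  shape = solve-∀
  by-quarters : ∀ N q r → r < 4 → (q + q) + (q + q) + r ≡ N →
                ∃ λ S → IsSepFamily (suc N) S × 4 * length S ≤ suc N + 16
  by-quarters N zero r r<4 refl =
    map [_] (allFin (suc r)) , singletons-family (suc r) ,
    subst (λ l → 4 * l ≤ suc r + 16) (sym (trans (length-map [_] (allFin (suc r))) (length-tabulate (λ i → i))))
          (≤-trans (*-monoʳ-≤ 4 r<4) (m≤n+m 16 (suc r)))
  by-quarters N (suc q) r r<4 N≡ =
    family , isSepFamily ,
    subst (λ l → 4 * l ≤ suc N + 16) (sym family-length)
          (subst (λ N → 4 * (2 + suc q + r) ≤ suc N + 16) N≡ (size-bound (suc q) r r<4))
    where open Construction N (suc q) r (s≤s z≤n) N≡

-- The bounds hold for every n.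
lemma12 : Σ ℕ λ C → (n : ℕ) → 4 ≤ n →
    Σ ℕ λ k → IsFanF n k × (4 * k ≤ n + 4 * C) × (n ≤ 4 * k + 4 * C)
lemma12 = 4 , λ n _ → fan-f-estimate n
  where
  fan-f-estimate : ∀ n → Σ ℕ λ k → IsFanF n k × (4 * k ≤ n + 16) × (n ≤ 4 * k + 16)
  fan-f-estimate n with upperBound n
  ... | S , family , size with fanF-exists family
  ...   | k , fanF , k≤|S| =
    k , fanF , ≤-trans (*-monoʳ-≤ 4 k≤|S|) size ,
    ≤-trans (fanF-lowerBound fanF) (≤-trans (≤-reflexive (+-comm 2 (4 * k))) (+-monoʳ-≤ (4 * k) (m≤m+n 2 14)))
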